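{- Let $k>2$ and let $(A_n)_{n\ge1}$ be the anti-$k$-bonacci sequence, i.e. the anti-recurrence sequence generated by $\mathbf a=(1,1,\ldots,1)\in\mathbb Z^k$. Let $i=\lfloor k/2\rfloor$, $\kappa=k^2+1$ and $I_n=[(n-1)\kappa+1,\,n\kappa]$. Then for every $n\ge1$, $A_n\in I_n$ and \[A_n\equiv ik+a_n \pmod{\kappa}\] for some integer $a_n$ with $1\le a_n\le k$ if $k$ is even, and $i+1\le a_n\le i+k$ if $k$ is odd.
   Context: Anti-recurrence sequence: given a vector $\mathbf a=(a_1,\ldots,a_k)$ of positive integers, $(A_n)_{n\ge1}$ and $(B_n)_{n\ge1}$ are the unique strictly increasing sequences of positive integers that are complementary (every positive integer lies in exactly one of them) and satisfy $A_n=\sum_{j=1}^k a_jB_{(n-1)k+j}$ for all $n\ge1$. $[a,b]$ denotes the set of integers $\{a,a+1,\ldots,b\}$. -}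

module Defs where

open import Data.Nat using (ℕ; zero; suc; _+_; _*_; _∸_; _≤_; _<_)
open import Data.Fin using (Fin; toℕ) renaming (zero to fzero; suc to fsuc)
open import Data.Product using (_×_; ∃-syntax)
open import Data.Sum using (_⊎_)
open import Relation.Nullary using (¬_)
open import Relation.Binary.PropositionalEquality using (_≡_)

-- Sequences are functions ℕ → ℕ, read with 1-based indices n ≥ 1
-- (the value at index 0 is irrelevant and unconstrained).

sumFin : ∀ k → (Fin k → ℕ) → ℕ
sumFin zero    f = 0
sumFin (suc k) f = f fzero + sumFin k (λ j → f (fsuc j))

StrictlyIncreasing : (ℕ → ℕ) → Set
StrictlyIncreasing f = ∀ m n → 1 ≤ m → m < n → f m < f n

PositiveSeq : (ℕ → ℕ) → Set
PositiveSeq f = ∀ n → 1 ≤ n → 1 ≤ f n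

IsTerm : (ℕ → ℕ) → ℕ → Set
IsTerm f x = ∃[ n ] (1 ≤ n × f n ≡ x)

Complementary : (ℕ → ℕ) → (ℕ → ℕ) → Set
Complementary A B =
  ∀ x → 1 ≤ x → (IsTerm A x ⊎ IsTerm B x) × ¬ (IsTerm A x × IsTerm B x)

-- (A,B) is the anti-recurrence pair generated by a = (a_1,…,a_k),
-- a_{j+1} = a j for j : Fin k.  Recurrence:
--   A_n = Σ_{j=1}^k a_j B_{(n-1)k+j}   for all n ≥ 1.
IsAntiRecurrence : ∀ k → (Fin k → ℕ) → (ℕ → ℕ) → (ℕ → ℕ) → Set
IsAntiRecurrence k a A B =
  PositiveSeq A × PositiveSeq B ×
  StrictlyIncreasing A × StrictlyIncreasing B ×
  Complementary A B ×
  (∀ n → 1 ≤ n →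
     A n ≡ sumFin k (λ j → a j * B ((n ∸ 1) * k + suc (toℕ j))))

ones : ∀ k → Fin k → ℕ
ones k _ = 1

-- Write K = k² + 1 and cut the positive integers into blocks of length K.
-- Consecutive terms of A are at least k² apart (A_{n+1} − A_n is a sum of k
-- differences of B's whose indices are k apart), so as long as A_1, …, A_{q+1}
-- sit at offsets r with 2 ≤ r ≤ k² in their blocks, block q contains A_{q+1}
-- and nothing else from A; its other k² numbers are B_{qk²+1}, …, B_{(q+1)k²}
-- in order, i.e. B_{qk²+u} = qK + u + [r ≤ u].  For m = s + qk with s < k,
-- A_{m+1} is the sum of the k consecutive terms B_{qk²+sk+1}, …, B_{qk²+sk+k},
-- which equals mK + ik + a with a = T_k − ik − s + #{u ∈ (sk, sk+k] : u ≥ r}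
-- (T_k = 1 + ⋯ + k).  Comparing s with i shows that a again lies in the
-- stated range, so strong induction on n closes the argument.

module Submission where

open import Defs
open import Data.Nat using (ℕ; suc; _+_; _*_; _∸_; _≤_; _<_; _/_; _%_)
open import Data.Product using (_×_; ∃-syntax)
open import Relation.Binary.PropositionalEquality using (_≡_)
open import Data.Bool.Base using (if_then_else_)
open import Data.Empty using (⊥-elim)
open import Data.Fin.Base using (Fin; toℕ) renaming (zero to fzero; suc to fsuc)
open import Data.Fin.Properties using (toℕ<n)
open import Data.Nat.Base using (zero; z≤n; s≤s; NonZero; >-nonZero)
open import Data.Nat.DivMod using (m≡m%n+[m/n]*n; m%n<n; m/n<m; [m+kn]%n≡m%n)
open import Data.Nat.Induction using (<-rec)
open import Data.Nat.Properties
open import Algebra.Properties.CommutativeSemigroup +-commutativeSemigroup using (interchange)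
open import Data.Nat.Tactic.RingSolver using (solve-∀)
open import Data.Product using (_,_; proj₁; proj₂)
open import Data.Sum.Base using (inj₁; inj₂)
open import Relation.Binary.Definitions using (tri<; tri≈; tri>)
open import Relation.Binary.PropositionalEquality using (refl; sym; trans; cong; cong₂; subst; _≢_; module ≡-Reasoning)
open import Relation.Nullary using (¬_; does; yes; no)
open import Relation.Nullary.Decidable using (dec-true; dec-false)

module _ {f : ℕ → ℕ} (inc : StrictlyIncreasing f) where

  StrictlyIncreasing⇒mono : ∀ {m n} → 1 ≤ m → m ≤ n → f m ≤ f n
  StrictlyIncreasing⇒mono {m} {n} 1≤m m≤n with m≤n⇒m<n∨m≡n m≤n
  ... | inj₁ m<n  = <⇒≤ (inc m n 1≤m m<n)
  ... | inj₂ refl = ≤-refl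

  StrictlyIncreasing⇒+-≤ : ∀ {m} d → 1 ≤ m → f m + d ≤ f (m + d)
  StrictlyIncreasing⇒+-≤ {m} zero    1≤m rewrite +-identityʳ m | +-identityʳ (f m) = ≤-refl
  StrictlyIncreasing⇒+-≤ {m} (suc d) 1≤m = begin
    f m + suc d       ≡⟨ +-suc (f m) d ⟩
    suc (f m + d)     ≤⟨ s≤s (StrictlyIncreasing⇒+-≤ d 1≤m) ⟩
    suc (f (m + d))   ≤⟨ inc (m + d) (suc (m + d)) (≤-trans 1≤m (m≤m+n m d)) ≤-refl ⟩
    f (suc (m + d))   ≡⟨ cong f (+-suc m d) ⟨
    f (m + suc d)     ∎
    where open ≤-Reasoning

  StrictlyIncreasing⇒≥id : PositiveSeq f → ∀ {n} → 1 ≤ n → n ≤ f n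
  StrictlyIncreasing⇒≥id pos {suc n} _ =
    ≤-trans (+-monoˡ-≤ n (pos 1 ≤-refl)) (StrictlyIncreasing⇒+-≤ n ≤-refl)

module ComplementaryPair {A B : ℕ → ℕ} (posA : PositiveSeq A)
  (incB : StrictlyIncreasing B) (comp : Complementary A B) where

  not-both : ∀ {x} → IsTerm A x → ¬ IsTerm B x
  not-both (n , 1≤n , refl) tB = proj₂ (comp (A n) (posA n 1≤n)) ((n , 1≤n , refl) , tB)

  non-A⇒B : ∀ {y} → 1 ≤ y → ¬ IsTerm A y → IsTerm B y
  non-A⇒B {y} 1≤y nA with proj₁ (comp y 1≤y)
  ... | inj₁ tA = ⊥-elim (nA tA)
  ... | inj₂ tB = tB

  B-suc≡ : ∀ {m y} → 1 ≤ m → B m < y → (∀ z → B m < z → z < y → IsTerm A z) →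
           ¬ IsTerm A y → B (suc m) ≡ y
  B-suc≡ {m} {y} 1≤m Bm<y between nA = ≤-antisym upper lower
    where
    upper : B (suc m) ≤ y
    upper with non-A⇒B (≤-trans (s≤s z≤n) Bm<y) nA
    ... | p , 1≤p , refl with suc m ≤? p
    ...   | yes m<p = StrictlyIncreasing⇒mono incB (s≤s z≤n) m<p
    ...   | no  m≮p = ⊥-elim (<⇒≱ Bm<y (StrictlyIncreasing⇒mono incB 1≤p (≤-pred (≰⇒> m≮p))))
    lower : y ≤ B (suc m)
    lower = ≮⇒≥ λ Bsm<y → not-both (between _ (incB m (suc m) 1≤m ≤-refl) Bsm<y) (suc m , s≤s z≤n , refl)

  B-suc≡suc : ∀ {m} → 1 ≤ m → ¬ IsTerm A (suc (B m)) → B (suc m) ≡ suc (B m)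
  B-suc≡suc 1≤m nA = B-suc≡ 1≤m ≤-refl (λ z Bm<z z<y → ⊥-elim (<⇒≱ Bm<z (≤-pred z<y))) nA

  B-suc≡2+ : ∀ {m} → 1 ≤ m → IsTerm A (suc (B m)) → ¬ IsTerm A (2 + B m) → B (suc m) ≡ 2 + B m
  B-suc≡2+ 1≤m tA nA =
    B-suc≡ 1≤m (n≤1+n _) (λ z Bm<z z<y → subst (IsTerm A) (≤-antisym Bm<z (≤-pred z<y)) tA) nA

  B-1≡1 : PositiveSeq B → ¬ IsTerm A 1 → B 1 ≡ 1
  B-1≡1 posB nA with non-A⇒B ≤-refl nA
  ... | p , 1≤p , B-p≡1 =
    ≤-antisym (subst (B 1 ≤_) B-p≡1 (StrictlyIncreasing⇒mono incB ≤-refl 1≤p)) (posB 1 ≤-refl)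

sumFin-cong : ∀ k {f g : Fin k → ℕ} → (∀ j → f j ≡ g j) → sumFin k f ≡ sumFin k g
sumFin-cong zero    f≡g = refl
sumFin-cong (suc k) f≡g = cong₂ _+_ (f≡g fzero) (sumFin-cong k (λ j → f≡g (fsuc j)))

sumFin-mono-≤ : ∀ k {f g : Fin k → ℕ} → (∀ j → f j ≤ g j) → sumFin k f ≤ sumFin k g
sumFin-mono-≤ zero    f≤g = z≤n
sumFin-mono-≤ (suc k) f≤g = +-mono-≤ (f≤g fzero) (sumFin-mono-≤ k (λ j → f≤g (fsuc j)))

sumFin-+-const : ∀ k (f : Fin k → ℕ) c → sumFin k (λ j → f j + c) ≡ sumFin k f + k * c
sumFin-+-const zero    f c = refl
sumFin-+-const (suc k) f c = begin
  f fzero + c + sumFin k (λ j → f (fsuc j) + c)     ≡⟨ cong (f fzero + c +_) (sumFin-+-const k (λ j → f (fsuc j)) c) ⟩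
  f fzero + c + (sumFin k (λ j → f (fsuc j)) + k * c) ≡⟨ interchange (f fzero) c _ (k * c) ⟩
  f fzero + sumFin k (λ j → f (fsuc j)) + (c + k * c) ∎
  where open ≡-Reasoning

window : (ℕ → ℕ) → ℕ → ℕ → ℕ
window g zero    c = 0
window g (suc k) c = g (suc c) + window g k (suc c)

sumFin≡window : ∀ g k c → sumFin k (λ j → g (c + suc (toℕ j))) ≡ window g k c
sumFin≡window g zero    c = refl
sumFin≡window g (suc k) c = cong₂ _+_ (cong g (+-comm c 1)) (begin
  sumFin k (λ j → g (c + suc (suc (toℕ j))))  ≡⟨ sumFin-cong k (λ j → cong g (+-suc c (suc (toℕ j)))) ⟩
  sumFin k (λ j → g (suc c + suc (toℕ j)))    ≡⟨ sumFin≡window g k (suc c) ⟩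
  window g k (suc c)                          ∎)
  where open ≡-Reasoning

window-cong : ∀ {g h} k c → (∀ u → c < u → u ≤ c + k → g u ≡ h u) → window g k c ≡ window h k c
window-cong zero    c g≡h = refl
window-cong (suc k) c g≡h = cong₂ _+_
  (g≡h (suc c) ≤-refl (subst (suc c ≤_) (sym (+-suc c k)) (s≤s (m≤m+n c k))))
  (window-cong k (suc c) λ u c<u u≤ → g≡h u (<⇒≤ c<u) (subst (u ≤_) (sym (+-suc c k)) u≤))

window-+ : ∀ g h k c → window (λ u → g u + h u) k c ≡ window g k c + window h k c
window-+ g h zero    c = refl
window-+ g h (suc k) c = trans (cong (g (suc c) + h (suc c) +_) (window-+ g h k (suc c)))
                               (interchange (g (suc c)) (h (suc c)) (window g k (suc c)) (window h k (suc c)))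

window-const : ∀ x k c → window (λ _ → x) k c ≡ k * x
window-const x zero    c = refl
window-const x (suc k) c = cong (x +_) (window-const x k (suc c))

triangle : ℕ → ℕ
triangle zero    = 0
triangle (suc k) = suc k + triangle k

window-id : ∀ k c → window (λ u → u) k c ≡ k * c + triangle k
window-id zero    c = refl
window-id (suc k) c = trans (cong (suc c +_) (window-id k (suc c))) (unfold k c (triangle k))
  where
  unfold : ∀ k c t → suc c + (k * suc c + t) ≡ suc k * c + (suc k + t)
  unfold = solve-∀

𝟙[_≤_] : ℕ → ℕ → ℕ
𝟙[ r ≤ u ] = if does (r ≤? u) then 1 else 0

𝟙-yes : ∀ {r u} → r ≤ u → 𝟙[ r ≤ u ] ≡ 1
𝟙-yes {r} {u} r≤u rewrite dec-true (r ≤? u) r≤u = refl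

𝟙-no : ∀ {r u} → u < r → 𝟙[ r ≤ u ] ≡ 0
𝟙-no {r} {u} u<r rewrite dec-false (r ≤? u) (<⇒≱ u<r) = refl

countAbove : ℕ → ℕ → ℕ → ℕ
countAbove r = window (λ u → 𝟙[ r ≤ u ])

countAbove-≤ : ∀ r k c → countAbove r k c ≤ k
countAbove-≤ r zero    c = z≤n
countAbove-≤ r (suc k) c with r ≤? suc c
... | yes r≤ = subst (λ x → x + countAbove r k (suc c) ≤ suc k) (sym (𝟙-yes r≤)) (s≤s (countAbove-≤ r k (suc c)))
... | no  r≰ = subst (λ x → x + countAbove r k (suc c) ≤ suc k) (sym (𝟙-no (≰⇒> r≰))) (m≤n⇒m≤1+n (countAbove-≤ r k (suc c)))

countAbove-none : ∀ {r} k c → c + k < r → countAbove r k c ≡ 0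
countAbove-none zero    c c<r = refl
countAbove-none {r} (suc k) c c+k<r = cong₂ _+_
  (𝟙-no (≤-<-trans (s≤s (m≤m+n c k)) c+1+k<r)) (countAbove-none k (suc c) c+1+k<r)
  where
  c+1+k<r : suc c + k < r
  c+1+k<r = subst (_< r) (+-suc c k) c+k<r

countAbove-all : ∀ {r} k c → r ≤ suc c → countAbove r k c ≡ k
countAbove-all zero    c r≤ = refl
countAbove-all (suc k) c r≤ = cong₂ _+_ (𝟙-yes r≤) (countAbove-all k (suc c) (m≤n⇒m≤1+n r≤))

countAbove-exact : ∀ {r} k c → suc c ≤ r → r ≤ suc (c + k) → countAbove r k c + r ≡ suc (c + k)
countAbove-exact {r} zero c c<r r≤ rewrite +-identityʳ c = ≤-antisym r≤ c<r
countAbove-exact {r} (suc k) c c<r r≤ with m≤n⇒m<n∨m≡n c<r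
... | inj₂ refl = begin
  𝟙[ suc c ≤ suc c ] + countAbove (suc c) k (suc c) + suc c ≡⟨ cong₂ (λ x y → x + y + suc c) (𝟙-yes {suc c} ≤-refl) (countAbove-all k (suc c) (n≤1+n (suc c))) ⟩
  suc k + suc c                                          ≡⟨ cong suc (+-comm k (suc c)) ⟩
  suc (suc c + k)                                        ≡⟨ cong suc (+-suc c k) ⟨
  suc (c + suc k)                                        ∎
  where open ≡-Reasoning
... | inj₁ c+1<r = begin
  𝟙[ r ≤ suc c ] + countAbove r k (suc c) + r ≡⟨ cong (λ x → x + countAbove r k (suc c) + r) (𝟙-no c+1<r) ⟩
  countAbove r k (suc c) + r                  ≡⟨ countAbove-exact k (suc c) c+1<r (subst (r ≤_) (cong suc (+-suc c k)) r≤) ⟩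
  suc (suc c + k)                             ≡⟨ cong suc (+-suc c k) ⟨
  suc (c + suc k)                             ∎
  where open ≡-Reasoning

countAbove-≥ : ∀ {r m} k c → m ≤ k → r + m ≤ suc (c + k) → m ≤ countAbove r k c
countAbove-≥ {r} {m} k c m≤k r+m≤ with r ≤? suc c
... | yes r≤ = subst (m ≤_) (sym (countAbove-all k c r≤)) m≤k
... | no  r≰ = +-cancelʳ-≤ r m (countAbove r k c) (begin
  m + r                  ≡⟨ +-comm m r ⟩
  r + m                  ≤⟨ r+m≤ ⟩
  suc (c + k)            ≡⟨ countAbove-exact k c (<⇒≤ (≰⇒> r≰)) (≤-trans (m≤m+n r m) r+m≤) ⟨
  countAbove r k c + r   ∎)
  where open ≤-Reasoning

countAbove-< : ∀ {r} k c → suc c < r → countAbove r (suc k) c ≤ k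
countAbove-< {r} k c c+1<r = subst (λ x → x + countAbove r k (suc c) ≤ k) (sym (𝟙-no c+1<r)) (countAbove-≤ r k (suc c))

triangle-even : ∀ i → triangle (i * 2) ≡ i * (i * 2) + i
triangle-even zero    = refl
triangle-even (suc i) = trans (cong (λ t → suc (suc (i * 2)) + (suc (i * 2) + t)) (triangle-even i)) (step i)
  where
  step : ∀ i → suc (suc (i * 2)) + (suc (i * 2) + (i * (i * 2) + i)) ≡ suc i * (suc i * 2) + suc i
  step = solve-∀

data Parity : ℕ → ℕ → Set where
  even : ∀ i → Parity (i * 2) i
  odd  : ∀ i → Parity (suc (i * 2)) i

offset : ∀ {k i} → Parity k i → ℕ
offset (even i)    = i
offset {k} (odd i) = k

Admissible : ∀ {k i} → Parity k i → ℕ → Set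
Admissible {k} (even i) a = 1 ≤ a × a ≤ k
Admissible {k} (odd i)  a = i + 1 ≤ a × a ≤ i + k

triangle≡offset : ∀ {k i} (p : Parity k i) → triangle k ≡ i * k + offset p
triangle≡offset (even i) = triangle-even i
triangle≡offset (odd i)  = trans (cong (suc (i * 2) +_) (triangle-even i)) (step i)
  where
  step : ∀ i → suc (i * 2) + (i * (i * 2) + i) ≡ i * suc (i * 2) + suc (i * 2)
  step = solve-∀

1+i≤i*2 : ∀ {i} → 1 ≤ i → suc i ≤ i * 2
1+i≤i*2 {i} 1≤i = subst (suc i ≤_) (*-comm 2 i) (+-mono-≤ 1≤i (m≤m+n i 0))

offset-admissible : ∀ {k i} (p : Parity k i) → 1 ≤ i → Admissible p (offset p)
offset-admissible (even i) 1≤i = 1≤i , ≤-trans (n≤1+n i) (1+i≤i*2 1≤i)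
offset-admissible (odd i)  1≤i =
  subst (_≤ suc (i * 2)) (+-comm 1 i) (s≤s (≤-trans (n≤1+n i) (1+i≤i*2 1≤i))) , m≤n+m _ i

admissible-residue : ∀ {k i a} (p : Parity k i) → 1 ≤ i → Admissible p a → 2 ≤ i * k + a × i * k + a ≤ k * k
admissible-residue {a = a} (even i) 1≤i (1≤a , a≤k) =
  +-mono-≤ (*-mono-≤ 1≤i (≤-trans 1≤i (≤-trans (n≤1+n i) (1+i≤i*2 1≤i)))) 1≤a , (begin
    i * k + a    ≤⟨ +-monoʳ-≤ (i * k) a≤k ⟩
    i * k + k    ≡⟨ +-comm (i * k) k ⟩
    suc i * k    ≤⟨ *-monoˡ-≤ k (1+i≤i*2 1≤i) ⟩
    k * k        ∎)
  where
  k : ℕ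
  k = i * 2
  open ≤-Reasoning
admissible-residue {a = a} (odd i) 1≤i (i+1≤a , a≤i+k) =
  ≤-trans (≤-trans (+-monoˡ-≤ 1 1≤i) i+1≤a) (m≤n+m a (i * k)) , (begin
    i * k + a          ≤⟨ +-monoʳ-≤ (i * k) a≤i+k ⟩
    i * k + (i + k)    ≤⟨ subst (i * k + (i + k) ≤_) (square i) (m≤m+n _ (i * (i * 2))) ⟩
    k * k              ∎)
  where
  k : ℕ
  k = suc (i * 2)
  open ≤-Reasoning
  square : ∀ i → i * suc (i * 2) + (i + suc (i * 2)) + i * (i * 2) ≡ suc (i * 2) * suc (i * 2)
  square = solve-∀

bounded-difference : ∀ {s lo hi n} → s + lo ≤ n → n ≤ s + hi → ∃[ a ] ((lo ≤ a × a ≤ hi) × s + a ≡ n)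
bounded-difference {s} {lo} {hi} {n} s+lo≤n n≤s+hi =
  n ∸ s ,
  (m+n≤o⇒m≤o∸n lo (subst (_≤ n) (+-comm s lo) s+lo≤n) , m≤n+o⇒m∸n≤o n s n≤s+hi) ,
  m+[n∸m]≡n (≤-trans (m≤m+n s lo) s+lo≤n)

s*k+k<i*k+a : ∀ {k s i a} → s < i → 1 ≤ a → s * k + k < i * k + a
s*k+k<i*k+a {k} {s} {i} {a} s<i 1≤a = begin-strict
  s * k + k   ≡⟨ +-comm (s * k) k ⟩
  suc s * k   ≤⟨ *-monoˡ-≤ k s<i ⟩
  i * k       <⟨ m<m+n (i * k) 1≤a ⟩
  i * k + a   ∎
  where open ≤-Reasoning

residue-step-even : ∀ {i s a'} → 1 ≤ i → s < i * 2 → 1 ≤ a' → a' ≤ i * 2 →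
  ∃[ a ] ((1 ≤ a × a ≤ i * 2) × s + a ≡ i + countAbove (i * (i * 2) + a') (i * 2) (s * (i * 2)))
residue-step-even {i} {s} {a'} 1≤i s<k 1≤a' a'≤k with <-cmp s i
... | tri< s<i _ _ = bounded-difference (begin
        s + 1       ≡⟨ +-comm s 1 ⟩
        suc s       ≤⟨ s<i ⟩
        i           ≤⟨ m≤m+n i cnt ⟩
        i + cnt     ∎) (begin
        i + cnt     ≡⟨ cong (i +_) (countAbove-none k (s * k) (s*k+k<i*k+a s<i 1≤a')) ⟩
        i + 0       ≡⟨ +-identityʳ i ⟩
        i           ≤⟨ ≤-trans (n≤1+n i) (1+i≤i*2 1≤i) ⟩
        k           ≤⟨ m≤n+m k s ⟩
        s + k       ∎)
  where
  k : ℕ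
  k = i * 2
  cnt : ℕ
  cnt = countAbove (i * k + a') k (s * k)
  open ≤-Reasoning
... | tri≈ _ refl _ = bounded-difference
        (+-monoʳ-≤ i (countAbove-≥ k (i * k) (≤-trans 1≤a' a'≤k) (begin
          i * k + a' + 1    ≡⟨ +-comm _ 1 ⟩
          suc (i * k + a')  ≤⟨ s≤s (+-monoʳ-≤ (i * k) a'≤k) ⟩
          suc (i * k + k)   ∎)))
        (+-monoʳ-≤ i (countAbove-≤ (i * k + a') k (i * k)))
  where
  k : ℕ
  k = i * 2
  open ≤-Reasoning
... | tri> _ _ i<s = bounded-difference (begin
        s + 1       ≡⟨ +-comm s 1 ⟩
        suc s       ≤⟨ s<k ⟩
        k           ≤⟨ m≤n+m k i ⟩
        i + k       ≡⟨ cong (i +_) all ⟨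
        i + cnt     ∎) (begin
        i + cnt     ≤⟨ +-monoʳ-≤ i (countAbove-≤ (i * k + a') k (s * k)) ⟩
        i + k       ≤⟨ +-monoˡ-≤ k (<⇒≤ i<s) ⟩
        s + k       ∎)
  where
  k : ℕ
  k = i * 2
  cnt : ℕ
  cnt = countAbove (i * k + a') k (s * k)
  open ≤-Reasoning
  all : cnt ≡ k
  all = countAbove-all k (s * k) (begin
    i * k + a'  ≤⟨ +-monoʳ-≤ (i * k) a'≤k ⟩
    i * k + k   ≡⟨ +-comm (i * k) k ⟩
    suc i * k   ≤⟨ *-monoˡ-≤ k i<s ⟩
    s * k       ≤⟨ n≤1+n _ ⟩
    suc (s * k) ∎)
residue-step-odd : ∀ {i s a'} → 1 ≤ i → s < suc (i * 2) → i + 1 ≤ a' → a' ≤ i + suc (i * 2) →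
  ∃[ a ] ((i + 1 ≤ a × a ≤ i + suc (i * 2)) ×
          s + a ≡ suc (i * 2) + countAbove (i * suc (i * 2) + a') (suc (i * 2)) (s * suc (i * 2)))
residue-step-odd {i} {s} {a'} 1≤i s<k i+1≤a' a'≤i+k with <-cmp s i
... | tri< s<i _ _ = bounded-difference (begin
        s + (i + 1)   ≤⟨ +-monoˡ-≤ (i + 1) (<⇒≤ s<i) ⟩
        i + (i + 1)   ≡⟨ 2i+1≡k i ⟩
        k             ≤⟨ m≤m+n k cnt ⟩
        k + cnt       ∎) (begin
        k + cnt       ≡⟨ cong (k +_) (countAbove-none k (s * k) (s*k+k<i*k+a s<i 1≤a')) ⟩
        k + 0         ≡⟨ +-identityʳ k ⟩
        k             ≤⟨ m≤n+m k i ⟩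
        i + k         ≤⟨ m≤n+m _ s ⟩
        s + (i + k)   ∎)
  where
  k : ℕ
  k = suc (i * 2)
  cnt : ℕ
  cnt = countAbove (i * k + a') k (s * k)
  1≤a' : 1 ≤ a'
  1≤a' = ≤-trans (m≤n+m 1 i) i+1≤a'
  open ≤-Reasoning
  2i+1≡k : ∀ i → i + (i + 1) ≡ suc (i * 2)
  2i+1≡k = solve-∀
... | tri≈ _ refl _ = bounded-difference (begin
        i + (i + 1)   ≡⟨ 2i+1≡k i ⟩
        k             ≤⟨ m≤m+n k _ ⟩
        k + cnt       ∎) (begin
        k + cnt       ≤⟨ +-monoʳ-≤ k (countAbove-< (i * 2) (i * k) (begin-strict
                           suc (i * k)   ≡⟨ +-comm 1 (i * k) ⟩
                           i * k + 1     <⟨ +-monoʳ-< (i * k) (≤-trans (+-monoˡ-≤ 1 1≤i) i+1≤a') ⟩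
                           i * k + a'    ∎)) ⟩
        k + i * 2     ≡⟨ 4i+1≡ i ⟩
        i + (i + k)   ∎)
  where
  k : ℕ
  k = suc (i * 2)
  cnt : ℕ
  cnt = countAbove (i * k + a') k (i * k)
  open ≤-Reasoning
  2i+1≡k : ∀ i → i + (i + 1) ≡ suc (i * 2)
  2i+1≡k = solve-∀
  4i+1≡ : ∀ i → suc (i * 2) + i * 2 ≡ i + (i + suc (i * 2))
  4i+1≡ = solve-∀
... | tri> _ _ i<s = bounded-difference (begin
        s + (i + 1)   ≡⟨ s+[i+1]≡ s i ⟩
        suc s + i     ≤⟨ +-monoˡ-≤ i s<k ⟩
        k + i         ≤⟨ +-monoʳ-≤ k i≤cnt ⟩
        k + cnt       ∎) (begin
        k + cnt       ≤⟨ +-monoʳ-≤ k (countAbove-≤ (i * k + a') k (s * k)) ⟩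
        k + k         ≡⟨ 2k≡ i ⟩
        suc i + i + k ≤⟨ +-monoˡ-≤ k (+-monoˡ-≤ i i<s) ⟩
        s + i + k     ≡⟨ +-assoc s i k ⟩
        s + (i + k)   ∎)
  where
  k : ℕ
  k = suc (i * 2)
  cnt : ℕ
  cnt = countAbove (i * k + a') k (s * k)
  open ≤-Reasoning
  2k≡ : ∀ i → suc (i * 2) + suc (i * 2) ≡ suc i + i + suc (i * 2)
  2k≡ = solve-∀
  gap : ∀ i → i * suc (i * 2) + (i + suc (i * 2)) + i + 2 ≡ suc (suc i * suc (i * 2) + suc (i * 2))
  gap = solve-∀
  s+[i+1]≡ : ∀ s i → s + (i + 1) ≡ suc s + i
  s+[i+1]≡ = solve-∀
  i≤cnt : i ≤ cnt
  i≤cnt = countAbove-≥ k (s * k) (≤-trans (n≤1+n i) (≤-trans (1+i≤i*2 1≤i) (n≤1+n _))) (begin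
    i * k + a' + i          ≤⟨ +-monoˡ-≤ i (+-monoʳ-≤ (i * k) a'≤i+k) ⟩
    i * k + (i + k) + i     ≤⟨ subst (i * k + (i + k) + i ≤_) (gap i) (m≤m+n _ 2) ⟩
    suc (suc i * k + k)     ≤⟨ s≤s (+-monoˡ-≤ k (*-monoˡ-≤ k i<s)) ⟩
    suc (s * k + k)         ∎)

residue-step : ∀ {k i s a'} (p : Parity k i) → 1 ≤ i → s < k → Admissible p a' →
  ∃[ a ] (Admissible p a × s + a ≡ offset p + countAbove (i * k + a') k (s * k))
residue-step (even i) 1≤i s<k (lo , hi) = residue-step-even 1≤i s<k lo hi
residue-step (odd i)  1≤i s<k (lo , hi) = residue-step-odd 1≤i s<k lo hi

window-block : ∀ X r k c →
  window (λ u → X + (u + 𝟙[ r ≤ u ])) k c ≡ k * X + (k * c + triangle k + countAbove r k c)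
window-block X r k c = begin
  window (λ u → X + (u + 𝟙[ r ≤ u ])) k c
    ≡⟨ window-+ (λ _ → X) (λ u → u + 𝟙[ r ≤ u ]) k c ⟩
  window (λ _ → X) k c + window (λ u → u + 𝟙[ r ≤ u ]) k c
    ≡⟨ cong₂ _+_ (window-const X k c) (window-+ (λ u → u) (λ u → 𝟙[ r ≤ u ]) k c) ⟩
  k * X + (window (λ u → u) k c + countAbove r k c)
    ≡⟨ cong (λ w → k * X + (w + countAbove r k c)) (window-id k c) ⟩
  k * X + (k * c + triangle k + countAbove r k c) ∎
  where open ≡-Reasoning

block-sum≡placement : ∀ {k i s q a off cnt} → triangle k ≡ i * k + off → s + a ≡ off + cnt →
  k * (q * suc (k * k)) + (k * (s * k) + triangle k + cnt) ≡ (s + q * k) * suc (k * k) + (i * k + a)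
block-sum≡placement {k} {i} {s} {q} {a} {off} {cnt} T≡ s+a≡ = begin
  k * (q * suc (k * k)) + (k * (s * k) + triangle k + cnt)
    ≡⟨ cong (λ t → k * (q * suc (k * k)) + (k * (s * k) + t + cnt)) T≡ ⟩
  k * (q * suc (k * k)) + (k * (s * k) + (i * k + off) + cnt)
    ≡⟨ reassoc k q s i off cnt ⟩
  k * (q * suc (k * k)) + k * (s * k) + i * k + (off + cnt)
    ≡⟨ cong (k * (q * suc (k * k)) + k * (s * k) + i * k +_) s+a≡ ⟨
  k * (q * suc (k * k)) + k * (s * k) + i * k + (s + a)
    ≡⟨ expand k q s i a ⟩
  (s + q * k) * suc (k * k) + (i * k + a) ∎
  where
  open ≡-Reasoning
  reassoc : ∀ k q s i off cnt → k * (q * suc (k * k)) + (k * (s * k) + (i * k + off) + cnt)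
                              ≡ k * (q * suc (k * k)) + k * (s * k) + i * k + (off + cnt)
  reassoc = solve-∀
  expand : ∀ k q s i a → k * (q * suc (k * k)) + k * (s * k) + i * k + (s + a)
                       ≡ (s + q * k) * suc (k * k) + (i * k + a)
  expand = solve-∀

sumFin-suc≡triangle : ∀ k → sumFin k (λ j → suc (toℕ j)) ≡ triangle k
sumFin-suc≡triangle k = trans (sumFin≡window (λ u → u) k 0) (trans (window-id k 0) (cong (_+ triangle k) (*-zeroʳ k)))

k<triangle : ∀ {k} → 2 ≤ k → k < triangle k
k<triangle {suc zero}    (s≤s ())
k<triangle {suc (suc k)} _ = m<m+n (suc (suc k)) (s≤s z≤n)

parity-2≤k : ∀ {k i} → Parity k i → 1 ≤ i → 2 ≤ k
parity-2≤k (even i) 1≤i = ≤-trans (s≤s 1≤i) (1+i≤i*2 1≤i)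
parity-2≤k (odd i)  1≤i = ≤-trans (s≤s 1≤i) (≤-trans (1+i≤i*2 1≤i) (n≤1+n _))

module AntiKBonacci {k i : ℕ} (p : Parity k i) (1≤i : 1 ≤ i) {A B : ℕ → ℕ}
  (posA : PositiveSeq A) (posB : PositiveSeq B)
  (incA : StrictlyIncreasing A) (incB : StrictlyIncreasing B) (comp : Complementary A B)
  (rec : ∀ n → 1 ≤ n → A n ≡ sumFin k (λ j → ones k j * B ((n ∸ 1) * k + suc (toℕ j))))
  where

  open ComplementaryPair posA incB comp

  K : ℕ
  K = suc (k * k)

  2≤k : 2 ≤ k
  2≤k = parity-2≤k p 1≤i

  A-rec : ∀ {n} → 1 ≤ n → A n ≡ sumFin k (λ j → B ((n ∸ 1) * k + suc (toℕ j)))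
  A-rec {n} 1≤n = trans (rec n 1≤n) (sumFin-cong k (λ j → *-identityˡ _))

  A-gap : ∀ {t} → 1 ≤ t → A t + k * k ≤ A (suc t)
  A-gap {suc t} _ = begin
    A (suc t) + k * k                                   ≡⟨ cong (_+ k * k) (A-rec (s≤s z≤n)) ⟩
    sumFin k (λ j → B (t * k + suc (toℕ j))) + k * k    ≡⟨ sumFin-+-const k _ k ⟨
    sumFin k (λ j → B (t * k + suc (toℕ j)) + k)        ≤⟨ sumFin-mono-≤ k shift ⟩
    sumFin k (λ j → B (suc t * k + suc (toℕ j)))        ≡⟨ A-rec (s≤s z≤n) ⟨
    A (suc (suc t))                                     ∎
    where
    open ≤-Reasoning
    reindex : ∀ t k x → t * k + x + k ≡ suc t * k + x
    reindex = solve-∀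
    shift : ∀ j → B (t * k + suc (toℕ j)) + k ≤ B (suc t * k + suc (toℕ j))
    shift j = subst (λ x → B (t * k + suc (toℕ j)) + k ≤ B x) (reindex t k (suc (toℕ j)))
      (StrictlyIncreasing⇒+-≤ incB k (≤-trans (s≤s z≤n) (m≤n+m (suc (toℕ j)) (t * k))))

  instance
    k-nonZero : NonZero k
    k-nonZero = >-nonZero (≤-trans (s≤s z≤n) 2≤k)

  A-term>k : ∀ {z} → IsTerm A z → k < z
  A-term>k (t , 1≤t , refl) = begin-strict
    k                                     <⟨ k<triangle 2≤k ⟩
    triangle k                            ≡⟨ sumFin-suc≡triangle k ⟨
    sumFin k (λ j → suc (toℕ j))          ≤⟨ sumFin-mono-≤ k (λ j → StrictlyIncreasing⇒≥id incB posB (s≤s z≤n)) ⟩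
    sumFin k (λ j → B (suc (toℕ j)))      ≡⟨ A-rec ≤-refl ⟨
    A 1                                   ≤⟨ StrictlyIncreasing⇒mono incA ≤-refl 1≤t ⟩
    A t                                   ∎
    where open ≤-Reasoning

  B-initial : ∀ u → suc u ≤ k → B (suc u) ≡ suc u
  B-initial zero    1≤k = B-1≡1 posB (λ tA → <⇒≱ (A-term>k tA) 1≤k)
  B-initial (suc u) u+2≤k = trans (B-suc≡suc (s≤s z≤n) not-A) (cong suc B-u+1)
    where
    B-u+1 : B (suc u) ≡ suc u
    B-u+1 = B-initial u (≤-trans (n≤1+n _) u+2≤k)
    not-A : ¬ IsTerm A (suc (B (suc u)))
    not-A tA = <⇒≱ (A-term>k (subst (λ y → IsTerm A (suc y)) B-u+1 tA)) u+2≤k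

  A-1≡triangle : A 1 ≡ triangle k
  A-1≡triangle = trans (A-rec ≤-refl)
    (trans (sumFin-cong k (λ j → B-initial (toℕ j) (toℕ<n j))) (sumFin-suc≡triangle k))

  AtResidue : ℕ → ℕ → Set
  AtResidue t r = A t ≡ (t ∸ 1) * K + r × 2 ≤ r × r ≤ k * k

  residue-bounds : ∀ {t r} → AtResidue (suc t) r → t * K + 2 ≤ A (suc t) × A (suc t) < suc t * K
  residue-bounds {t} {r} (eq , 2≤r , r≤kk) =
    subst (t * K + 2 ≤_) (sym eq) (+-monoʳ-≤ (t * K) 2≤r) , (begin-strict
      A (suc t)      ≡⟨ eq ⟩
      t * K + r      ≤⟨ +-monoʳ-≤ (t * K) r≤kk ⟩
      t * K + k * k  <⟨ +-monoʳ-< (t * K) ≤-refl ⟩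
      t * K + K      ≡⟨ +-comm (t * K) K ⟩
      suc t * K      ∎)
    where open ≤-Reasoning

  ResiduesUpTo : ℕ → Set
  ResiduesUpTo q = ∀ t → 1 ≤ t → t ≤ q → ∃[ r ] AtResidue t r

  A-term-in-block : ∀ {q r y} → ResiduesUpTo q → AtResidue (suc q) r →
               q * K < y → y ≤ suc q * K → IsTerm A y → y ≡ q * K + r
  A-term-in-block {q} E R qK<y y≤ (suc t , _ , refl) with <-cmp (suc t) (suc q)
  ... | tri≈ _ refl _ = proj₁ R
  ... | tri< t<q _ _ with E (suc t) (s≤s z≤n) (≤-pred t<q)
  ...   | _ , R′ = ⊥-elim (<⇒≱ qK<y (<⇒≤ (<-≤-trans (proj₂ (residue-bounds R′)) (*-monoˡ-≤ K (≤-pred t<q)))))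
  A-term-in-block {q} {r} E R qK<y y≤ (suc t , _ , refl) | tri> _ _ q<t = ⊥-elim (<⇒≱ (begin-strict
    suc q * K                   ≡⟨ +-comm K (q * K) ⟩
    q * K + K                   <⟨ ≤-reflexive (unfold q k) ⟩
    q * K + 2 + k * k           ≤⟨ +-monoˡ-≤ (k * k) (proj₁ (residue-bounds R)) ⟩
    A (suc q) + k * k           ≤⟨ A-gap (s≤s z≤n) ⟩
    A (suc (suc q))             ≤⟨ StrictlyIncreasing⇒mono incA (s≤s z≤n) q<t ⟩
    A (suc t)                   ∎) y≤)
    where
    open ≤-Reasoning
    unfold : ∀ q k → suc (q * suc (k * k) + suc (k * k)) ≡ q * suc (k * k) + 2 + k * k
    unfold = solve-∀

  non-A-in-block : ∀ {q r v} → ResiduesUpTo q → AtResidue (suc q) r → v ≤ k * k → suc v ≢ r →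
                   ¬ IsTerm A (suc (q * K + v))
  non-A-in-block {q} {r} {v} E R v≤kk v+1≢r tA = v+1≢r (+-cancelˡ-≡ (q * K) _ _
    (trans (+-suc (q * K) v) (A-term-in-block E R (s≤s (m≤m+n (q * K) v)) y≤ tA)))
    where
    y≤ : suc (q * K + v) ≤ suc q * K
    y≤ = begin
      suc (q * K + v)  ≡⟨ +-suc (q * K) v ⟨
      q * K + suc v    ≤⟨ +-monoʳ-≤ (q * K) (s≤s v≤kk) ⟩
      q * K + K        ≡⟨ +-comm (q * K) K ⟩
      suc q * K        ∎
      where open ≤-Reasoning

  B-step : ∀ {q r m u} → ResiduesUpTo q → AtResidue (suc q) r → 1 ≤ m → u < k * k →
           B m ≡ q * K + (u + 𝟙[ r ≤ u ]) → B (suc m) ≡ q * K + (suc u + 𝟙[ r ≤ suc u ])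
  B-step {q} {r} {m} {u} E R 1≤m u<kk Bm with <-cmp r (suc u)
  ... | tri< r<u+1 _ _ = begin
    B (suc m)                          ≡⟨ B-suc≡suc 1≤m (subst (λ b → ¬ IsTerm A (suc b)) (sym Bm′) not-A) ⟩
    suc (B m)                          ≡⟨ cong suc Bm′ ⟩
    suc (q * K + (u + 1))              ≡⟨ +-suc (q * K) (u + 1) ⟨
    q * K + (suc u + 1)                ≡⟨ cong (λ b → q * K + (suc u + b)) (𝟙-yes (<⇒≤ r<u+1)) ⟨
    q * K + (suc u + 𝟙[ r ≤ suc u ])   ∎
    where
    open ≡-Reasoning
    Bm′ : B m ≡ q * K + (u + 1)
    Bm′ = trans Bm (cong (λ b → q * K + (u + b)) (𝟙-yes (≤-pred r<u+1)))
    not-A : ¬ IsTerm A (suc (q * K + (u + 1)))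
    not-A = non-A-in-block E R (subst (_≤ k * k) (+-comm 1 u) u<kk)
      (λ e → <⇒≱ r<u+1 (subst (suc u ≤_) e (m≤m+n (suc u) 1)))
  ... | tri≈ _ refl _ = begin
    B (suc m)                          ≡⟨ B-suc≡2+ 1≤m A-next not-A ⟩
    2 + B m                            ≡⟨ cong (2 +_) Bm′ ⟩
    2 + (q * K + u)                    ≡⟨ reassoc (q * K) u ⟩
    q * K + (suc u + 1)                ≡⟨ cong (λ b → q * K + (suc u + b)) (𝟙-yes (≤-refl {suc u})) ⟨
    q * K + (suc u + 𝟙[ suc u ≤ suc u ]) ∎
    where
    open ≡-Reasoning
    reassoc : ∀ x u → 2 + (x + u) ≡ x + (suc u + 1)
    reassoc = solve-∀
    Bm′ : B m ≡ q * K + u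
    Bm′ = trans Bm (cong (q * K +_) (trans (cong (u +_) (𝟙-no (n<1+n u))) (+-identityʳ u)))
    A-next : IsTerm A (suc (B m))
    A-next = suc q , s≤s z≤n , trans (proj₁ R) (trans (+-suc (q * K) u) (cong suc (sym Bm′)))
    not-A : ¬ IsTerm A (2 + B m)
    not-A tA = non-A-in-block E R u<kk (λ e → 1+n≢n e)
      (subst (IsTerm A) (trans (cong (2 +_) Bm′) (cong suc (sym (+-suc (q * K) u)))) tA)
  ... | tri> _ _ u+1<r = begin
    B (suc m)                          ≡⟨ B-suc≡suc 1≤m (subst (λ b → ¬ IsTerm A (suc b)) (sym Bm′) not-A) ⟩
    suc (B m)                          ≡⟨ cong suc Bm′ ⟩
    suc (q * K + u)                    ≡⟨ +-suc (q * K) u ⟨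
    q * K + suc u                      ≡⟨ cong (q * K +_) (+-identityʳ (suc u)) ⟨
    q * K + (suc u + 0)                ≡⟨ cong (λ b → q * K + (suc u + b)) (𝟙-no u+1<r) ⟨
    q * K + (suc u + 𝟙[ r ≤ suc u ])   ∎
    where
    open ≡-Reasoning
    Bm′ : B m ≡ q * K + u
    Bm′ = trans Bm (cong (q * K +_) (trans (cong (u +_) (𝟙-no (<-trans (n<1+n u) u+1<r))) (+-identityʳ u)))
    not-A : ¬ IsTerm A (suc (q * K + u))
    not-A = non-A-in-block E R (<⇒≤ u<kk) (<⇒≢ u+1<r)

  1≤kk : 1 ≤ k * k
  1≤kk = *-mono-≤ (≤-trans (s≤s z≤n) 2≤k) (≤-trans (s≤s z≤n) 2≤k)

  ResiduesUpTo-pred : ∀ {q} → ResiduesUpTo (suc q) → ResiduesUpTo q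
  ResiduesUpTo-pred E t 1≤t t≤q = E t 1≤t (m≤n⇒m≤1+n t≤q)

  B-block : ∀ q {r} → ResiduesUpTo q → AtResidue (suc q) r → ∀ u → 1 ≤ u → u ≤ k * k →
            B (q * (k * k) + u) ≡ q * K + (u + 𝟙[ r ≤ u ])
  B-block-start : ∀ q {r} → ResiduesUpTo q → AtResidue (suc q) r → B (q * (k * k) + 1) ≡ q * K + 1

  B-block q E R (suc zero) _ _ =
    trans (B-block-start q E R) (cong (λ b → q * K + (1 + b)) (sym (𝟙-no (proj₁ (proj₂ R)))))
  B-block q E R (suc (suc u)) _ u+2≤kk = trans (cong B (+-suc (q * (k * k)) (suc u)))
    (B-step E R (≤-trans (s≤s z≤n) (m≤n+m (suc u) (q * (k * k)))) u+2≤kk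
      (B-block q E R (suc u) (s≤s z≤n) (≤-trans (n≤1+n _) u+2≤kk)))

  B-block-start zero E R = B-1≡1 posB (non-A-in-block E R z≤n (λ { refl → 1+n≰n (proj₁ (proj₂ R)) }))
  B-block-start (suc q) {r} E R with E (suc q) (s≤s z≤n) ≤-refl
  ... | r′ , R′ = begin
    B (suc q * (k * k) + 1)            ≡⟨ cong B (reindex q (k * k)) ⟩
    B (suc (q * (k * k) + k * k))      ≡⟨ B-suc≡suc (≤-trans 1≤kk (m≤n+m _ _)) not-A ⟩
    suc (B (q * (k * k) + k * k))      ≡⟨ cong suc B-last ⟩
    suc (suc q * K)                    ≡⟨ +-comm 1 (suc q * K) ⟩
    suc q * K + 1                      ∎
    where
    open ≡-Reasoning
    reindex : ∀ q kk → suc q * kk + 1 ≡ suc (q * kk + kk)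
    reindex = solve-∀
    close : ∀ q kk → q * suc kk + (kk + 1) ≡ suc q * suc kk
    close = solve-∀
    B-last : B (q * (k * k) + k * k) ≡ suc q * K
    B-last = trans (B-block q (ResiduesUpTo-pred E) R′ (k * k) 1≤kk ≤-refl)
      (trans (cong (λ b → q * K + (k * k + b)) (𝟙-yes (proj₂ (proj₂ R′)))) (close q (k * k)))
    not-A : ¬ IsTerm A (suc (B (q * (k * k) + k * k)))
    not-A = subst (λ b → ¬ IsTerm A (suc b)) (trans (+-identityʳ _) (sym B-last))
      (non-A-in-block E R z≤n (λ { refl → 1+n≰n (proj₁ (proj₂ R)) }))

  Placed : ℕ → Set
  Placed t = ∃[ a ] (Admissible p a × A t ≡ (t ∸ 1) * K + (i * k + a))

  Placed⇒AtResidue : ∀ {t} → Placed t → ∃[ r ] AtResidue t r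
  Placed⇒AtResidue (a , adm , eq) = i * k + a , eq , admissible-residue p 1≤i adm

  placed-1 : Placed 1
  placed-1 = offset p , offset-admissible p 1≤i , trans A-1≡triangle (triangle≡offset p)

  placed-block : ∀ {s q} → s < k → (∀ t → 1 ≤ t → t ≤ suc q → Placed t) → Placed (suc (s + q * k))
  placed-block {s} {q} s<k IH with IH (suc q) (s≤s z≤n) ≤-refl
  ... | a′ , adm′ , A-q+1 with residue-step p 1≤i s<k adm′
  ... | a , adm , s+a≡ = a , adm , (begin
    A (suc (s + q * k))
      ≡⟨ A-rec (s≤s z≤n) ⟩
    sumFin k (λ j → B ((s + q * k) * k + suc (toℕ j)))
      ≡⟨ sumFin-cong k (λ j → cong B (reindex s q k (suc (toℕ j)))) ⟩
    sumFin k (λ j → B (q * (k * k) + (s * k + suc (toℕ j))))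
      ≡⟨ sumFin≡window (λ u → B (q * (k * k) + u)) k (s * k) ⟩
    window (λ u → B (q * (k * k) + u)) k (s * k)
      ≡⟨ window-cong k (s * k) (λ u sk<u u≤ → B-block q E R u (≤-trans (s≤s z≤n) sk<u) (≤-trans u≤ sk+k≤kk)) ⟩
    window (λ u → q * K + (u + 𝟙[ r ≤ u ])) k (s * k)
      ≡⟨ window-block (q * K) r k (s * k) ⟩
    k * (q * K) + (k * (s * k) + triangle k + countAbove r k (s * k))
      ≡⟨ block-sum≡placement {k} {i} {s} {q} {a} (triangle≡offset p) s+a≡ ⟩
    (s + q * k) * K + (i * k + a) ∎)
    where
    open ≡-Reasoning
    r : ℕ
    r = i * k + a′
    E : ResiduesUpTo q
    E t 1≤t t≤q = Placed⇒AtResidue (IH t 1≤t (m≤n⇒m≤1+n t≤q))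
    R : AtResidue (suc q) r
    R = A-q+1 , admissible-residue p 1≤i adm′
    reindex : ∀ s q k x → (s + q * k) * k + x ≡ q * (k * k) + (s * k + x)
    reindex = solve-∀
    sk+k≤kk : s * k + k ≤ k * k
    sk+k≤kk = subst (_≤ k * k) (+-comm k (s * k)) (*-monoˡ-≤ k s<k)

  placed : ∀ n → 1 ≤ n → Placed n
  placed = <-rec (λ n → 1 ≤ n → Placed n) step
    where
    step : ∀ n → (∀ {t} → t < n → 1 ≤ t → Placed t) → 1 ≤ n → Placed n
    step (suc zero)    _  _ = placed-1
    step (suc (suc m)) IH _ = subst Placed (cong suc (sym (m≡m%n+[m/n]*n (suc m) k)))
      (placed-block (m%n<n (suc m) k) λ t 1≤t t≤ →
        IH (s≤s (≤-trans t≤ (m/n<m (suc m) k 2≤k))) 1≤t)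

  A-placed : ∀ n → 1 ≤ n →
    ((n ∸ 1) * K + 1 ≤ A n × A n ≤ n * K) × ∃[ a ] (A n % K ≡ (i * k + a) % K × Admissible p a)
  A-placed (suc n) 1≤n with placed (suc n) 1≤n
  ... | a , adm , A-n = (≤-trans (+-monoʳ-≤ (n * K) (s≤s z≤n)) (proj₁ bounds) , <⇒≤ (proj₂ bounds)) ,
    a , trans (cong (_% K) (trans A-n (+-comm (n * K) (i * k + a)))) ([m+kn]%n≡m%n (i * k + a) n K) , adm
    where
    bounds : n * K + 2 ≤ A (suc n) × A (suc n) < suc n * K
    bounds = residue-bounds (A-n , admissible-residue p 1≤i adm)

parity-1≤i : ∀ {k i} → Parity k i → 2 < k → 1 ≤ i
parity-1≤i (even (suc i)) _ = s≤s z≤n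
parity-1≤i (odd zero)     (s≤s ())
parity-1≤i (odd (suc i))  _ = s≤s z≤n

anti-k-bonacci : ∀ k i e → k ≡ e + i * 2 → e < 2 → 2 < k → (A B : ℕ → ℕ) →
  IsAntiRecurrence k (ones k) A B → ∀ n → 1 ≤ n →
    ((n ∸ 1) * suc (k * k) + 1 ≤ A n × A n ≤ n * suc (k * k)) ×
    (∃[ an ] (A n % suc (k * k) ≡ (i * k + an) % suc (k * k) ×
      (e ≡ 0 → 1 ≤ an × an ≤ k) ×
      (e ≡ 1 → i + 1 ≤ an × an ≤ i + k)))
anti-k-bonacci .(i * 2) i zero refl _ 2<k A B (posA , posB , incA , incB , comp , rec) n 1≤n
  with AntiKBonacci.A-placed (even i) (parity-1≤i (even i) 2<k) posA posB incA incB comp rec n 1≤n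
... | bounds , a , a-mod , adm = bounds , a , a-mod , (λ _ → adm) , λ ()
anti-k-bonacci .(suc (i * 2)) i (suc zero) refl _ 2<k A B (posA , posB , incA , incB , comp , rec) n 1≤n
  with AntiKBonacci.A-placed (odd i) (parity-1≤i (odd i) 2<k) posA posB incA incB comp rec n 1≤n
... | bounds , a , a-mod , adm = bounds , a , a-mod , (λ ()) , λ _ → adm
anti-k-bonacci _ _ (suc (suc _)) _ (s≤s (s≤s ()))

lemma7 : ∀ (k : ℕ) → 2 < k → (A B : ℕ → ℕ) → IsAntiRecurrence k (ones k) A B →
    ∀ n → 1 ≤ n →
      ((n ∸ 1) * suc (k * k) + 1 ≤ A n × A n ≤ n * suc (k * k)) ×
      (∃[ an ] (A n % suc (k * k) ≡ ((k / 2) * k + an) % suc (k * k) ×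
        (k % 2 ≡ 0 → 1 ≤ an × an ≤ k) ×
        (k % 2 ≡ 1 → k / 2 + 1 ≤ an × an ≤ k / 2 + k)))
lemma7 k = anti-k-bonacci k (k / 2) (k % 2) (m≡m%n+[m/n]*n k 2) (m%n<n k 2)
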